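{- Let $\ell$ and $b$ be nonzero integers and let $\mathbf{s}$ be defined by $s_0=0$, $s_1=1$, $s_j=\ell s_{j-1}+bs_{j-2}$ for $j\geq2$. Let $r=\gcd(\ell,b)$, $t=\gcd(\ell^2/r,\,b/r)$ and $\sigma=r/t$. Then for every $n\geq1$, $s_n$ is divisible by $t^{n-1}\sigma^{\lfloor n/2\rfloor}$. -}

module Defs where

open import Data.Nat as ℕ using (ℕ; zero; suc)
open import Data.Nat.DivMod using (_/_)
open import Data.Nat.GCD using (gcd)
open import Data.Integer as ℤ using (ℤ; ∣_∣)

s : ℤ → ℤ → ℕ → ℤ
s ℓ b zero = ℤ.0ℤ
s ℓ b (suc zero) = ℤ.1ℤ
s ℓ b (suc (suc j)) = ℓ ℤ.* s ℓ b (suc j) ℤ.+ b ℤ.* s ℓ b j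

-- Exact division on ℕ (only used with nonzero divisors that divide exactly);
-- defined by cases so no NonZero instance is needed (value 0 for divisor 0).
_÷_ : ℕ → ℕ → ℕ
m ÷ zero = zero
m ÷ suc n = m / suc n

r : ℤ → ℤ → ℕ
r ℓ b = gcd ∣ ℓ ∣ ∣ b ∣

t : ℤ → ℤ → ℕ
t ℓ b = gcd ((∣ ℓ ∣ ℕ.* ∣ ℓ ∣) ÷ r ℓ b) (∣ b ∣ ÷ r ℓ b)

σ : ℤ → ℤ → ℕ
σ ℓ b = r ℓ b ÷ t ℓ b

module Submission where

-- Write L = |ℓ|, B = |b|, r = gcd L B and t = gcd (L²/r) (B/r).
-- Since L/r and B/r are coprime and t ∣ B/r, t is coprime to L/r; as
-- L²/r = (L/r)·(L/r)·r this forces t ∣ r, so σ = r/t satisfies t·σ = r.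
-- Hence t·σ ∣ ℓ, and t·(t·σ) = t·r ∣ (B/r)·r = B.
--
-- The theorem then follows from a general fact about the recurrence
-- s(n+2) = ℓ·s(n+1) + b·s(n): if p ∣ ℓ, q ∣ b, and a sequence d of weights
-- with d 1 ∣ 1 satisfies d(n+2) ∣ p·d(n+1) and d(n+2) ∣ q·d(n), then d n ∣ s n.
-- It is applied with p = t·σ, q = t²·σ and d n = t^(n-1)·σ^⌊n/2⌋, for which
-- the two weight conditions reduce to inequalities between exponents.

open import Defs
open import Data.Nat as ℕ using (ℕ; _^_; _∸_; _/_; _≤_)
open import Data.Integer as ℤ using (ℤ; +_; 0ℤ)
open import Data.Integer.Divisibility using (_∣_)
open import Relation.Binary.PropositionalEquality using (_≢_)

open import Data.Nat using (zero; suc; s≤s; z≤n; NonZero; ≢-nonZero)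
open import Data.Nat.Properties using (*-comm; n≤1+n; m≤n+m∸n)
open import Data.Nat.DivMod using (m/n*n≡m; m*[n/m]≡n; *-/-assoc; m/n≡1+[m∸n]/n; /-monoˡ-≤)
open import Data.Nat.GCD using (gcd; gcd[m,n]∣m; gcd[m,n]∣n; gcd[m,n]≡0⇒m≡0)
open import Data.Nat.Coprimality using (Coprime; coprime-/gcd; coprime-divisor)
import Data.Nat.Divisibility as ℕ∣
open ℕ∣ using (∣-trans; *-pres-∣; *-monoʳ-∣; *-monoˡ-∣; 1∣_; _∣0; 0∣⇒≡0; module ∣-Reasoning)
import Data.Integer.Divisibility.Signed as Signed
open import Data.Integer.Properties using (abs-*; ∣i∣≡0⇒i≡0)
open import Data.Nat.Tactic.RingSolver using (solve-∀)
open import Data.Product using (_×_; _,_; proj₁)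
open import Function using (_∘_)
open import Relation.Binary.PropositionalEquality using (_≡_; refl; sym; trans; cong; subst)

-- Exact division undoes multiplication; this also holds for the divisor 0,
-- because 0 only divides 0.
*-÷-inverse : ∀ {m n} → n ℕ∣.∣ m → n ℕ.* (m ÷ n) ≡ m
*-÷-inverse {n = zero}  0∣m = sym (0∣⇒≡0 0∣m)
*-÷-inverse {n = suc _} n∣m = m*[n/m]≡n n∣m

÷≡/ : ∀ m n .{{_ : NonZero n}} → m ÷ n ≡ m / n
÷≡/ m (suc n) = refl

^-monoʳ-∣ : ∀ m {i j} → i ≤ j → m ^ i ℕ∣.∣ m ^ j
^-monoʳ-∣ m z≤n       = 1∣ _
^-monoʳ-∣ m (s≤s i≤j) = *-monoʳ-∣ m (^-monoʳ-∣ m i≤j)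

-- Key divisibility: if g ∣ L and L/g, B/g are coprime, then every common
-- divisor of L²/g and B/g divides g (it is coprime to L/g, and L²/g = (L/g)·(L/g)·g).
common-divisor-of-reduced∣ : ∀ {L B g u} .{{_ : NonZero g}} → g ℕ∣.∣ L →
  Coprime (L / g) (B / g) → u ℕ∣.∣ (L ℕ.* L) / g → u ℕ∣.∣ B / g → u ℕ∣.∣ g
common-divisor-of-reduced∣ {L} {B} {g} {u} g∣L coprime u∣L²/g u∣B/g =
  coprime-divisor u⊥L/g (subst (u ℕ∣.∣_) L≡[L/g]*g u∣L)
  where
    u⊥L/g : Coprime u (L / g)
    u⊥L/g (d∣u , d∣L/g) = coprime (d∣L/g , ∣-trans d∣u u∣B/g)
    L²/g≡[L/g]*L : (L ℕ.* L) / g ≡ (L / g) ℕ.* L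
    L²/g≡[L/g]*L = trans (*-/-assoc L g∣L) (*-comm L (L / g))
    u∣L : u ℕ∣.∣ L
    u∣L = coprime-divisor u⊥L/g (subst (u ℕ∣.∣_) L²/g≡[L/g]*L u∣L²/g)
    L≡[L/g]*g : L ≡ (L / g) ℕ.* g
    L≡[L/g]*g = sym (m/n*n≡m g∣L)

reduced-gcd∣gcd : ∀ L B → L ≢ 0 →
  gcd ((L ℕ.* L) ÷ gcd L B) (B ÷ gcd L B) ℕ∣.∣ gcd L B
reduced-gcd∣gcd L B L≢0 = common-divisor-of-reduced∣ {L} {B}
  (gcd[m,n]∣m L B) (coprime-/gcd L B)
  (subst (u ℕ∣.∣_) (÷≡/ (L ℕ.* L) (gcd L B)) (gcd[m,n]∣m ((L ℕ.* L) ÷ gcd L B) (B ÷ gcd L B)))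
  (subst (u ℕ∣.∣_) (÷≡/ B (gcd L B)) (gcd[m,n]∣n ((L ℕ.* L) ÷ gcd L B) (B ÷ gcd L B)))
  where
    instance
      gcd-nonZero : NonZero (gcd L B)
      gcd-nonZero = ≢-nonZero (L≢0 ∘ gcd[m,n]≡0⇒m≡0)
    u : ℕ
    u = gcd ((L ℕ.* L) ÷ gcd L B) (B ÷ gcd L B)

reduced-gcd*gcd∣ : ∀ L B → gcd ((L ℕ.* L) ÷ gcd L B) (B ÷ gcd L B) ℕ.* gcd L B ℕ∣.∣ B
reduced-gcd*gcd∣ L B = subst (gcd ((L ℕ.* L) ÷ gcd L B) (B ÷ gcd L B) ℕ.* gcd L B ℕ∣.∣_) [B÷g]*g≡B
  (*-monoˡ-∣ (gcd L B) (gcd[m,n]∣n ((L ℕ.* L) ÷ gcd L B) (B ÷ gcd L B)))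
  where
    [B÷g]*g≡B : (B ÷ gcd L B) ℕ.* gcd L B ≡ B
    [B÷g]*g≡B = trans (*-comm (B ÷ gcd L B) (gcd L B)) (*-÷-inverse (gcd[m,n]∣n L B))

tσ≡r : ∀ ℓ b → ℓ ≢ 0ℤ → t ℓ b ℕ.* σ ℓ b ≡ r ℓ b
tσ≡r ℓ b ℓ≢0 = *-÷-inverse (reduced-gcd∣gcd ℤ.∣ ℓ ∣ ℤ.∣ b ∣ (ℓ≢0 ∘ ∣i∣≡0⇒i≡0))

tσ∣ℓ : ∀ ℓ b → ℓ ≢ 0ℤ → + (t ℓ b ℕ.* σ ℓ b) ∣ ℓ
tσ∣ℓ ℓ b ℓ≢0 = subst (ℕ∣._∣ ℤ.∣ ℓ ∣) (sym (tσ≡r ℓ b ℓ≢0)) (gcd[m,n]∣m ℤ.∣ ℓ ∣ ℤ.∣ b ∣)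

ttσ∣b : ∀ ℓ b → ℓ ≢ 0ℤ → + (t ℓ b ℕ.* (t ℓ b ℕ.* σ ℓ b)) ∣ b
ttσ∣b ℓ b ℓ≢0 = subst (λ k → t ℓ b ℕ.* k ℕ∣.∣ ℤ.∣ b ∣) (sym (tσ≡r ℓ b ℓ≢0))
  (reduced-gcd*gcd∣ ℤ.∣ ℓ ∣ ℤ.∣ b ∣)

half-suc-suc : ∀ n → suc (suc n) / 2 ≡ suc (n / 2)
half-suc-suc n = m/n≡1+[m∸n]/n {suc (suc n)} {2} (s≤s (s≤s z≤n))

module Weights (T S : ℕ) where

  weight : ℕ → ℕ
  weight n = T ^ (n ∸ 1) ℕ.* S ^ (n / 2)

  weight-step₁ : ∀ n → weight (suc (suc n)) ℕ∣.∣ (T ℕ.* S) ℕ.* weight (suc n)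
  weight-step₁ n = begin
    T ^ suc n ℕ.* S ^ (suc (suc n) / 2)
      ≡⟨ cong (λ k → T ^ suc n ℕ.* S ^ k) (half-suc-suc n) ⟩
    T ^ suc n ℕ.* S ^ suc (n / 2)
      ∣⟨ *-monoʳ-∣ (T ^ suc n) (^-monoʳ-∣ S (s≤s (/-monoˡ-≤ 2 (n≤1+n n)))) ⟩
    T ^ suc n ℕ.* S ^ suc (suc n / 2)
      ≡⟨ interchange T S (T ^ n) (S ^ (suc n / 2)) ⟨
    (T ℕ.* S) ℕ.* (T ^ n ℕ.* S ^ (suc n / 2)) ∎
    where
      open ∣-Reasoning
      interchange : ∀ a c x y → a ℕ.* c ℕ.* (x ℕ.* y) ≡ a ℕ.* x ℕ.* (c ℕ.* y)
      interchange = solve-∀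

  weight-step₂ : ∀ n → weight (suc (suc n)) ℕ∣.∣ (T ℕ.* (T ℕ.* S)) ℕ.* weight n
  weight-step₂ n = begin
    T ^ suc n ℕ.* S ^ (suc (suc n) / 2)
      ≡⟨ cong (λ k → T ^ suc n ℕ.* S ^ k) (half-suc-suc n) ⟩
    T ^ suc n ℕ.* S ^ suc (n / 2)
      ∣⟨ *-monoˡ-∣ (S ^ suc (n / 2)) (^-monoʳ-∣ T (s≤s (m≤n+m∸n n 1))) ⟩
    T ^ suc (suc (n ∸ 1)) ℕ.* S ^ suc (n / 2)
      ≡⟨ interchange T S (T ^ (n ∸ 1)) (S ^ (n / 2)) ⟨
    (T ℕ.* (T ℕ.* S)) ℕ.* (T ^ (n ∸ 1) ℕ.* S ^ (n / 2)) ∎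
    where
      open ∣-Reasoning
      interchange : ∀ a c x y → a ℕ.* (a ℕ.* c) ℕ.* (x ℕ.* y) ≡ a ℕ.* (a ℕ.* x) ℕ.* (c ℕ.* y)
      interchange = solve-∀

*-pres-∣ᵤ : ∀ {p q} {x y : ℤ} → + p ∣ x → + q ∣ y → + (p ℕ.* q) ∣ x ℤ.* y
*-pres-∣ᵤ {p} {q} {x} {y} p∣x q∣y =
  subst (p ℕ.* q ℕ∣.∣_) (sym (abs-* x y)) (*-pres-∣ p∣x q∣y)

∣m∣n⇒∣m+n : ∀ {k x y : ℤ} → k ∣ x → k ∣ y → k ∣ x ℤ.+ y
∣m∣n⇒∣m+n {k} {x} {y} k∣x k∣y =
  Signed.∣⇒∣ᵤ (Signed.∣m∣n⇒∣m+n (Signed.∣ᵤ⇒∣ {k} {x} k∣x) (Signed.∣ᵤ⇒∣ {k} {y} k∣y))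

recurrence-divisibility : ∀ {ℓ b : ℤ} (d : ℕ → ℕ) {p q : ℕ} → + p ∣ ℓ → + q ∣ b →
  d 1 ℕ∣.∣ 1 →
  (∀ n → d (suc (suc n)) ℕ∣.∣ p ℕ.* d (suc n)) →
  (∀ n → d (suc (suc n)) ℕ∣.∣ q ℕ.* d n) →
  ∀ n → + d n ∣ s ℓ b n
recurrence-divisibility {ℓ} {b} d p∣ℓ q∣b d₁∣1 step₁ step₂ n = proj₁ (consecutive n)
  where
    consecutive : ∀ n → + d n ∣ s ℓ b n × + d (suc n) ∣ s ℓ b (suc n)
    consecutive zero = (d 0 ∣0) , d₁∣1
    consecutive (suc n) with consecutive n
    ... | dₙ∣sₙ , dₙ₊₁∣sₙ₊₁ = dₙ₊₁∣sₙ₊₁ , ∣m∣n⇒∣m+n {+ d (suc (suc n))} {ℓ ℤ.* s ℓ b (suc n)} {b ℤ.* s ℓ b n}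
      (∣-trans (step₁ n) (*-pres-∣ᵤ {x = ℓ} {y = s ℓ b (suc n)} p∣ℓ dₙ₊₁∣sₙ₊₁))
      (∣-trans (step₂ n) (*-pres-∣ᵤ {x = b} {y = s ℓ b n} q∣b dₙ∣sₙ))

lemma3p6 : (ℓ b : ℤ) → ℓ ≢ 0ℤ → b ≢ 0ℤ → (n : ℕ) → 1 ≤ n →
    (+ ((t ℓ b ^ (n ∸ 1)) ℕ.* (σ ℓ b ^ (n / 2)))) ∣ s ℓ b n
lemma3p6 ℓ b ℓ≢0 _ n _ =
  recurrence-divisibility weight (tσ∣ℓ ℓ b ℓ≢0) (ttσ∣b ℓ b ℓ≢0)
    (ℕ∣.∣-refl {1}) weight-step₁ weight-step₂ n
  where open Weights (t ℓ b) (σ ℓ b)
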